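{- There exists a letter-oriented NMDA $\mathcal{A}$ such that no integral NDA $\mathcal{B}$ satisfies $\mathcal{B}(w)=\mathcal{A}(w)$ for all finite words $w$, and no integral NDA $\mathcal{B}$ satisfies $\mathcal{B}(w)=\mathcal{A}(w)$ for all infinite words $w$.
   Context: An alphabet $\Sigma$ is a finite nonempty set; finite words range over $\Sigma^+$. An NMDA is a tuple $\mathcal{A}=\langle \Sigma,Q,\iota,\delta,\gamma,\rho\rangle$ with finite state set $Q$, initial states $\iota\subseteq Q$, transition relation $\delta\subseteq Q\times\Sigma\times Q$, weight function $\gamma:\delta\to\mathbb{Q}$ and discount-factor function $\rho:\delta\to\mathbb{Q}\cap(1,\infty)$; NMDAs are assumed complete. A run on a word $w=\sigma_0\sigma_1\cdots$ is $p_0,\sigma_0,p_1,\ldots$ with $p_0\in\iota$ and $t_i=(p_i,\sigma_i,p_{i+1})\in\delta$; its value is $\sum_{i}\gamma(t_i)\prod_{j<i}\frac{1}{\rho(t_j)}$, and $\mathcal{A}(w)$ is the infimum of values of runs on $w$. An NMDA is integral if all discount factors are integers. An integral NDA is an NMDA in which all transitions have the same discount factor, which is an integer $\geq2$. An NMDA is letter-oriented if it is integral and there is a function $\Lambda:\Sigma\to\mathbb{N}\setminus\{0,1\}$ such that every transition $(q,\sigma,q')\in\delta$ has discount factor $\Lambda(\sigma)$. -}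

module Defs where

open import Data.Nat using (ℕ; zero; suc; _≤_)
open import Data.Integer using (+_)
open import Data.Fin using (Fin)
open import Data.Bool using (Bool; T)
open import Data.List using (List; []; _∷_)
open import Data.Product using (Σ; _×_; _,_; ∃; ∃-syntax)
open import Data.Rational using (ℚ; 0ℚ; 1ℚ; _+_; _*_; _<_; 1/_; _/_)
import Data.Rational as ℚ
open import Data.Rational.Properties using (pos⇒nonZero; <-trans)
open import Relation.Binary.PropositionalEquality using (_≡_)

ℕtoℚ : ℕ → ℚ
ℕtoℚ n = (+ n) / 1

inv>1 : (r : ℚ) → 1ℚ < r → ℚ
inv>1 r p = (1/ r) {{pos⇒nonZero r {{ℚ.positive (<-trans (ℚ.*<* (Data.Integer.+<+ (Data.Nat.s≤s Data.Nat.z≤n))) p)}}}}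
  where import Data.Integer ; import Data.Nat

-- States are Fin m.
-- ι, δ are characteristic functions of the initial states / transition relation.
-- γ and ρ are given on all triples; only their values on δ matter.
-- Discount factors are required to be > 1 on every triple (harmless convention).
record NMDA (k : ℕ) : Set where
  field
    m        : ℕ
    ι        : Fin m → Bool
    δ        : Fin m → Fin k → Fin m → Bool
    γ        : Fin m → Fin k → Fin m → ℚ
    ρ        : Fin m → Fin k → Fin m → ℚ
    ρ>1      : ∀ p σ q → 1ℚ < ρ p σ q
    init-ne  : ∃[ p ] T (ι p)
    complete : ∀ p σ → ∃[ q ] T (δ p σ q)

  ρ⁻¹ : Fin m → Fin k → Fin m → ℚ
  ρ⁻¹ p σ q = inv>1 (ρ p σ q) (ρ>1 p σ q)

  -- finite words
  -- FRun p w : a run on w starting in state p (not necessarily initial)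
  data FRun : Fin m → List (Fin k) → Set where
    done : ∀ p → FRun p []
    step : ∀ {p σ ws} q → T (δ p σ q) → FRun q ws → FRun p (σ ∷ ws)

  -- value  Σ_i γ(t_i) Π_{j<i} 1/ρ(t_j)
  fval : ∀ {p w} → FRun p w → ℚ
  fval (done _) = 0ℚ
  fval (step {p} {σ} q _ r) = γ p σ q + ρ⁻¹ p σ q * fval r

  IsInfValue : List (Fin k) → ℚ → Set
  IsInfValue w x =
    (∀ p → T (ι p) → (r : FRun p w) → x Data.Rational.≤ fval r) ×
    (∀ y → (∀ p → T (ι p) → (r : FRun p w) → y Data.Rational.≤ fval r) → y Data.Rational.≤ x)

  record IRun (w : ℕ → Fin k) : Set where
    field
      st    : ℕ → Fin m
      st-init : T (ι (st 0))
      st-step : ∀ i → T (δ (st i) (w i) (st (suc i)))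

  disc : ∀ {w} → IRun w → ℕ → ℚ
  disc r zero = 1ℚ
  disc {w} r (suc n) = disc r n * ρ⁻¹ (IRun.st r n) (w n) (IRun.st r (suc n))

  partial : ∀ {w} → IRun w → ℕ → ℚ
  partial r zero = 0ℚ
  partial {w} r (suc n) = partial r n + γ (IRun.st r n) (w n) (IRun.st r (suc n)) * disc r n

  -- value(r) < q   (value = limit of partial sums):
  -- for some ε > 0, eventually partial sums are ≤ q - ε
  ValLess : ∀ {w} → IRun w → ℚ → Set
  ValLess r q = ∃[ ε ] (0ℚ < ε × ∃[ n ] (∀ j → n ≤ j → partial r j + ε Data.Rational.≤ q))

  -- A(w) < q,  where A(w) = inf over runs
  InfLess : (ℕ → Fin k) → ℚ → Set
  InfLess w q = ∃[ r ] ValLess {w} r q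

FinEq : ∀ {k} → NMDA k → NMDA k → List (Fin k) → Set
FinEq A B w = ∃[ x ] (NMDA.IsInfValue A w x × NMDA.IsInfValue B w x)

-- equality of the real values A(w), B(w) on an infinite word, via their strict upper cuts in ℚ
InfEq : ∀ {k} → NMDA k → NMDA k → (ℕ → Fin k) → Set
InfEq A B w = ∀ q → (NMDA.InfLess A w q → NMDA.InfLess B w q) × (NMDA.InfLess B w q → NMDA.InfLess A w q)

IsIntegral : ∀ {k} → NMDA k → Set
IsIntegral A = ∀ p σ q → T (δ p σ q) → ∃[ n ] (ρ p σ q ≡ ℕtoℚ n)
  where open NMDA A

IsIntegralNDA : ∀ {k} → NMDA k → Set
IsIntegralNDA A = Σ ℕ λ λ' → (2 ≤ λ' × (∀ p σ q → T (δ p σ q) → ρ p σ q ≡ ℕtoℚ λ'))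
  where open NMDA A

IsLetterOriented : ∀ {k} → NMDA k → Set
IsLetterOriented {k} A = IsIntegral A ×
  Σ (Fin k → ℕ) λ Λ → ((∀ (σ : Fin k) → 2 ≤ Λ σ) × (∀ p σ q → T (δ p σ q) → ρ p σ q ≡ ℕtoℚ (Λ σ)))
  where open NMDA A

-- 𝒜 has a single state; the letters a, b, c cost 0, 1, 0 and are discounted by 2, 2, 3. Let B be an
-- integral NDA with discount factor λ, weights bounded by M and a common denominator D of its weights.
--
-- If λ ≥ 3, compare aⁿb with aⁿa (or aⁿba^ω with aⁿaa^ω): 𝒜 tells them apart by 2⁻ⁿ, while changing the
-- letters after position n moves the value of a run of B by at most 4M·λ⁻ⁿ ≤ 4M·3⁻ⁿ.
--
-- If λ = 2, the value of a run of B over n letters lies in (1/(D·2ⁿ))ℤ. On finite words this is incompatible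
-- with 𝒜(cⁿb) = 3⁻ⁿ for large n. On the infinite words cⁿba^ω, valued 3⁻ⁿ by 𝒜, take for each n a run of
-- value below (5/4)·3⁻ⁿ; by pigeonhole two of them, for n < n′, are in the same state after n resp. n′
-- letters. Exchanging their prefixes must not produce a run below 𝒜's value, and this confines the
-- difference u of the prefix values, scaled by 2ⁿ resp. 2ⁿ′, to (2/3)ⁿ/6 < u < (5/4)(2/3)ⁿ. For large n that
-- interval contains no point of (1/D)ℤ.

module Submission where

open import Defs
open import Algebra.Bundles using (CommutativeRing)
open import Data.Bool using (T; true)
open import Data.Empty using (⊥; ⊥-elim)
open import Data.Fin using (Fin; zero; suc; toℕ)
open import Data.Fin.Properties using (pigeonhole)
open import Data.Integer as ℤ using (+_; -[1+_])
import Data.Integer.Properties as ℤₚ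
open import Data.List using (List; []; _∷_; _++_; replicate; length)
open import Data.List.Properties using (length-++; length-replicate)
open import Data.Nat as ℕ using (ℕ; zero; suc; z≤n; s≤s)
import Data.Nat.Coprimality as Coprimality
open import Data.Nat.Divisibility using (_∣_; divides; ∣-trans; m∣m*n; ∣n⇒∣m*n)
import Data.Nat.Properties as ℕₚ
open import Data.Product using (∃-syntax; _×_; _,_; proj₁; proj₂)
open import Data.Rational as ℚ
  using (ℚ; mkℚ; 0ℚ; 1ℚ; ½; _+_; _*_; _-_; -_; 1/_; _≤_; _<_; _⊔_; ∣_∣; ↥_; ↧_; ↧ₙ_; *≤*; *<*)
open import Data.Rational.Literals using (fromℤ)
open import Data.Rational.Properties
open import Data.Rational.Solver using (module +-*-Solver)
import Data.Rational.Unnormalised.Base as ℚᵘ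
import Data.Rational.Unnormalised.Properties as ℚᵘ
open import Data.Unit using (tt)
open import Function.Base using (_∘_)
open import Function.Bundles using (_⇔_; mk⇔; Equivalence)
open import Relation.Binary.PropositionalEquality
open import Relation.Nullary using (¬_; yes; no)
open import Relation.Nullary.Decidable using (toWitness)
open import Algebra.Properties.CommutativeSemiring.Exp (CommutativeRing.commutativeSemiring +-*-commutativeRing)
  using (_^_; ^-homo-*; ^-distrib-*)
open +-*-Solver

IsInteger : ℚ → Set
IsInteger x = ∃[ z ] x ≡ fromℤ z

/1≡fromℤ : ∀ z → z ℚ./ 1 ≡ fromℤ z
/1≡fromℤ (+ n)    = normalize-coprime (Coprimality.sym (Coprimality.1-coprimeTo n))
/1≡fromℤ -[1+ n ] = cong -_ (normalize-coprime (Coprimality.sym (Coprimality.1-coprimeTo (suc n))))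

fromℤ-+ : ∀ a b → fromℤ a + fromℤ b ≡ fromℤ (a ℤ.+ b)
fromℤ-+ a b = trans (/1≡fromℤ _) (cong fromℤ (cong₂ ℤ._+_ (ℤₚ.*-identityʳ a) (ℤₚ.*-identityʳ b)))

fromℤ-neg : ∀ a → - fromℤ a ≡ fromℤ (ℤ.- a)
fromℤ-neg (+ zero)  = refl
fromℤ-neg (+ suc n) = refl
fromℤ-neg -[1+ n ]  = refl

fromℤ-suc : ∀ n → fromℤ (+ suc n) ≡ fromℤ (+ n) + 1ℚ
fromℤ-suc n = trans (cong (λ k → fromℤ (+ k)) (ℕₚ.+-comm 1 n)) (sym (fromℤ-+ (+ n) (+ 1)))

isInteger-ℕ : ∀ n → IsInteger (ℕtoℚ n)
isInteger-ℕ n = + n , /1≡fromℤ (+ n)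

isInteger-+ : ∀ {x y} → IsInteger x → IsInteger y → IsInteger (x + y)
isInteger-+ (a , refl) (b , refl) = a ℤ.+ b , fromℤ-+ a b

isInteger-- : ∀ {x y} → IsInteger x → IsInteger y → IsInteger (x - y)
isInteger-- (a , refl) (b , refl) = a ℤ.- b , trans (cong (_+_ (fromℤ a)) (fromℤ-neg b)) (fromℤ-+ a (ℤ.- b))

isInteger-* : ∀ {x y} → IsInteger x → IsInteger y → IsInteger (x * y)
isInteger-* (a , refl) (b , refl) = a ℤ.* b , /1≡fromℤ (a ℤ.* b)

fromℤ-mono-< : ∀ {a b} → a ℤ.< b → fromℤ a < fromℤ b
fromℤ-mono-< {a} {b} a<b = *<* (subst₂ ℤ._<_ (sym (ℤₚ.*-identityʳ a)) (sym (ℤₚ.*-identityʳ b)) a<b)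

fromℤ-mono-≤ : ∀ {a b} → a ℤ.≤ b → fromℤ a ≤ fromℤ b
fromℤ-mono-≤ {a} {b} a≤b = *≤* (subst₂ ℤ._≤_ (sym (ℤₚ.*-identityʳ a)) (sym (ℤₚ.*-identityʳ b)) a≤b)

isInteger-pos⇒1≤ : ∀ {x} → IsInteger x → 0ℚ < x → 1ℚ ≤ x
isInteger-pos⇒1≤ (+ zero , refl)  0<0 = ⊥-elim (<-irrefl refl 0<0)
isInteger-pos⇒1≤ (+ suc n , refl) _   = *≤* (ℤ.+≤+ (s≤s z≤n))
isInteger-pos⇒1≤ (-[1+ n ] , refl) (*<* ())

isInteger-^ : ∀ {x} n → IsInteger x → IsInteger (x ^ n)
isInteger-^ zero    _   = + 1 , refl
isInteger-^ (suc n) x∈ℤ = isInteger-* x∈ℤ (isInteger-^ n x∈ℤ)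

finite-commonMultiple : ∀ n (f : Fin n → ℕ) → (∀ i → 0 ℕ.< f i) → ∃[ d ] (0 ℕ.< d × ∀ i → f i ∣ d)
finite-commonMultiple zero    f _     = 1 , s≤s z≤n , λ ()
finite-commonMultiple (suc n) f 0<f = f zero ℕ.* d , ℕₚ.*-mono-≤ (0<f zero) 0<d , f∣fd
  where
  d = proj₁ (finite-commonMultiple n (f ∘ suc) (0<f ∘ suc))
  0<d = proj₁ (proj₂ (finite-commonMultiple n (f ∘ suc) (0<f ∘ suc)))
  f∣fd : ∀ i → f i ∣ f zero ℕ.* d
  f∣fd zero    = m∣m*n d
  f∣fd (suc i) = ∣n⇒∣m*n (f zero) (proj₂ (proj₂ (finite-commonMultiple n (f ∘ suc) (0<f ∘ suc))) i)

↧*≡↥ : ∀ x → fromℤ (↧ x) * x ≡ fromℤ (↥ x)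
↧*≡↥ x@(mkℚ n d _) = toℚᵘ-injective (ℚᵘ.≃-trans (toℚᵘ-homo-* (fromℤ (↧ x)) x) (ℚᵘ.*≡* eq))
  where
  open ≡-Reasoning
  eq : (+ suc d ℤ.* n) ℤ.* + 1 ≡ n ℤ.* + suc (ℕ.pred (1 ℕ.* suc d))
  eq = begin
    (+ suc d ℤ.* n) ℤ.* + 1                ≡⟨ ℤₚ.*-identityʳ _ ⟩
    + suc d ℤ.* n                          ≡⟨ ℤₚ.*-comm (+ suc d) n ⟩
    n ℤ.* + suc d                          ≡⟨ cong (λ k → n ℤ.* + suc k) (sym (ℕₚ.+-identityʳ d)) ⟩
    n ℤ.* + suc (ℕ.pred (1 ℕ.* suc d))     ∎

isInteger-denominator-multiple : ∀ x {d} → ↧ₙ x ∣ d → IsInteger (fromℤ (+ d) * x)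
isInteger-denominator-multiple x (divides c refl) = subst IsInteger (sym eq) (isInteger-* (+ c , refl) (↥ x , refl))
  where
  open ≡-Reasoning
  eq : fromℤ (+ (c ℕ.* ↧ₙ x)) * x ≡ fromℤ (+ c) * fromℤ (↥ x)
  eq = begin
    fromℤ (+ (c ℕ.* ↧ₙ x)) * x         ≡⟨ cong (λ z → fromℤ z * x) (ℤₚ.pos-* c (↧ₙ x)) ⟩
    fromℤ (+ c ℤ.* ↧ x) * x            ≡⟨ cong (_* x) (sym (/1≡fromℤ (+ c ℤ.* ↧ x))) ⟩
    fromℤ (+ c) * fromℤ (↧ x) * x      ≡⟨ *-assoc (fromℤ (+ c)) (fromℤ (↧ x)) x ⟩
    fromℤ (+ c) * (fromℤ (↧ x) * x)    ≡⟨ cong (fromℤ (+ c) *_) (↧*≡↥ x) ⟩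
    fromℤ (+ c) * fromℤ (↥ x)          ∎

0<↧ₙ : ∀ x → 0 ℕ.< ↧ₙ x
0<↧ₙ (mkℚ _ _ _) = s≤s z≤n

*-monoˡ-≤′ : ∀ {r p q} → 0ℚ ≤ r → p ≤ q → r * p ≤ r * q
*-monoˡ-≤′ {r} 0≤r = *-monoˡ-≤-nonNeg r {{ℚ.nonNegative 0≤r}}

*-monoʳ-≤′ : ∀ {r p q} → 0ℚ ≤ r → p ≤ q → p * r ≤ q * r
*-monoʳ-≤′ {r} 0≤r = *-monoʳ-≤-nonNeg r {{ℚ.nonNegative 0≤r}}

*-monoˡ-<′ : ∀ {r p q} → 0ℚ < r → p < q → r * p < r * q
*-monoˡ-<′ {r} 0<r = *-monoʳ-<-pos r {{ℚ.positive 0<r}}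

*-cancelˡ-≤′ : ∀ {r p q} → 0ℚ < r → r * p ≤ r * q → p ≤ q
*-cancelˡ-≤′ {r} 0<r = *-cancelˡ-≤-pos r {{ℚ.positive 0<r}}

*-cancelˡ-<′ : ∀ {r p q} → 0ℚ ≤ r → r * p < r * q → p < q
*-cancelˡ-<′ {r} 0≤r = *-cancelˡ-<-nonNeg r {{ℚ.nonNegative 0≤r}}

*-nonNeg : ∀ {p q} → 0ℚ ≤ p → 0ℚ ≤ q → 0ℚ ≤ p * q
*-nonNeg {p} {q} 0≤p 0≤q = subst (_≤ p * q) (*-zeroʳ p) (*-monoˡ-≤′ 0≤p 0≤q)

*-pos : ∀ {p q} → 0ℚ < p → 0ℚ < q → 0ℚ < p * q
*-pos {p} {q} 0<p 0<q = subst (_< p * q) (*-zeroʳ p) (*-monoˡ-<′ 0<p 0<q)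

x≤y+∣x∣+∣y∣ : ∀ x y → x ≤ y + (∣ x ∣ + ∣ y ∣)
x≤y+∣x∣+∣y∣ x y = begin
  x                     ≡⟨ solve 2 (λ x y → x := y :+ (x :- y)) refl x y ⟩
  y + (x - y)           ≤⟨ +-monoʳ-≤ y (≤-trans (p≤∣p∣ (x - y)) (∣p-q∣≤∣p∣+∣q∣ x y)) ⟩
  y + (∣ x ∣ + ∣ y ∣)   ∎
  where
  open ≤-Reasoning
  p≤∣p∣ : ∀ p → p ≤ ∣ p ∣
  p≤∣p∣ (mkℚ (+ n) _ _)    = ≤-refl
  p≤∣p∣ (mkℚ -[1+ n ] _ _) = *≤* ℤ.-≤+

finite-upperBound : ∀ n (f : Fin n → ℚ) → ∃[ M ] (0ℚ ≤ M × ∀ i → f i ≤ M)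
finite-upperBound zero    f = 0ℚ , ≤-refl , λ ()
finite-upperBound (suc n) f = f zero ⊔ M , p≤q⇒p≤r⊔q (f zero) 0≤M , bound
  where
  M = proj₁ (finite-upperBound n (f ∘ suc))
  0≤M = proj₁ (proj₂ (finite-upperBound n (f ∘ suc)))
  bound : ∀ i → f i ≤ f zero ⊔ M
  bound zero    = p≤p⊔q (f zero) M
  bound (suc i) = p≤q⇒p≤r⊔q (f zero) (proj₂ (proj₂ (finite-upperBound n (f ∘ suc))) i)

⅓ ⅔ : ℚ
⅓ = + 1 ℚ./ 3
⅔ = + 2 ℚ./ 3

^-nonNeg : ∀ {x} n → 0ℚ ≤ x → 0ℚ ≤ x ^ n
^-nonNeg zero    _   = toWitness {a? = 0ℚ ≤? 1ℚ} _
^-nonNeg (suc n) 0≤x = *-nonNeg 0≤x (^-nonNeg n 0≤x)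

^-pos : ∀ {x} n → 0ℚ < x → 0ℚ < x ^ n
^-pos zero    _   = toWitness {a? = 0ℚ <? 1ℚ} _
^-pos (suc n) 0<x = *-pos 0<x (^-pos n 0<x)

^-mono-≤ : ∀ {x y} n → 0ℚ ≤ x → x ≤ y → x ^ n ≤ y ^ n
^-mono-≤ zero    _   _   = ≤-refl
^-mono-≤ (suc n) 0≤x x≤y =
  ≤-trans (*-monoʳ-≤′ (^-nonNeg n 0≤x) x≤y) (*-monoˡ-≤′ (≤-trans 0≤x x≤y) (^-mono-≤ n 0≤x x≤y))

1^n≡1 : ∀ n → 1ℚ ^ n ≡ 1ℚ
1^n≡1 zero    = refl
1^n≡1 (suc n) = trans (*-identityˡ _) (1^n≡1 n)

^-inverse : ∀ {x y} n → x * y ≡ 1ℚ → x ^ n * y ^ n ≡ 1ℚ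
^-inverse {x} {y} n xy≡1 = trans (sym (^-distrib-* x y n)) (trans (cong (_^ n) xy≡1) (1^n≡1 n))

^-antimono : ∀ {x} {m n} → 0ℚ ≤ x → x ≤ 1ℚ → m ℕ.≤ n → x ^ n ≤ x ^ m
^-antimono {x} {m} 0≤x x≤1 m≤n with ℕₚ.m≤n⇒∃[o]m+o≡n m≤n
... | o , refl = begin
  x ^ (m ℕ.+ o)  ≡⟨ ^-homo-* x m o ⟩
  x ^ m * x ^ o  ≤⟨ *-monoˡ-≤′ (^-nonNeg m 0≤x) (subst (x ^ o ≤_) (1^n≡1 o) (^-mono-≤ o 0≤x x≤1)) ⟩
  x ^ m * 1ℚ     ≡⟨ *-identityʳ _ ⟩
  x ^ m          ∎
  where open ≤-Reasoning

bernoulli-⅔ : ∀ n → fromℤ (+ (n ℕ.+ 2)) * ⅔ ^ n ≤ fromℤ (+ 2)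
bernoulli-⅔ zero    = toWitness {a? = fromℤ (+ 2) * 1ℚ ≤? fromℤ (+ 2)} _
bernoulli-⅔ (suc n) = begin
  fromℤ (+ suc (n ℕ.+ 2)) * (⅔ * ⅔ ^ n)
    ≡⟨ cong (_* (⅔ * ⅔ ^ n)) (fromℤ-suc (n ℕ.+ 2)) ⟩
  (a + 1ℚ) * (⅔ * ⅔ ^ n)
    ≡⟨ solve 2 (λ a t → (a :+ con 1ℚ) :* (con ⅔ :* t) := con ⅔ :* (a :* t) :+ con ⅔ :* t) refl a (⅔ ^ n) ⟩
  ⅔ * (a * ⅔ ^ n) + ⅔ * ⅔ ^ n
    ≤⟨ +-mono-≤ (*-monoˡ-≤′ 0≤⅔ (bernoulli-⅔ n)) (*-monoˡ-≤′ 0≤⅔ ⅔^n≤1) ⟩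
  ⅔ * fromℤ (+ 2) + ⅔ * 1ℚ
    ≡⟨⟩
  fromℤ (+ 2) ∎
  where
  open ≤-Reasoning
  a = fromℤ (+ (n ℕ.+ 2))
  0≤⅔ = toWitness {a? = 0ℚ ≤? ⅔} _
  ⅔^n≤1 : ⅔ ^ n ≤ 1ℚ
  ⅔^n≤1 = ^-antimono {m = 0} {n} 0≤⅔ (toWitness {a? = ⅔ ≤? 1ℚ} _) z≤n

ceilingℕ : ∀ K → ∃[ a ] K ≤ fromℤ (+ a)
ceilingℕ (mkℚ (+ n) _ _)    = n , *≤* (ℤₚ.*-monoˡ-≤-nonNeg (+ n) (ℤ.+≤+ (s≤s z≤n)))
ceilingℕ (mkℚ -[1+ n ] _ _) = 0 , *≤* ℤ.-≤+

⅔^n-eventually-small : ∀ K → ∃[ N ] ∀ n → N ℕ.≤ n → K * ⅔ ^ n < 1ℚ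
⅔^n-eventually-small K = a ℕ.+ a , small
  where
  a = proj₁ (ceilingℕ K)
  0≤2 = toWitness {a? = 0ℚ ≤? fromℤ (+ 2)} _
  0≤⅔ = toWitness {a? = 0ℚ ≤? ⅔} _
  0<⅔ = toWitness {a? = 0ℚ <? ⅔} _
  small : ∀ n → a ℕ.+ a ℕ.≤ n → K * ⅔ ^ n < 1ℚ
  small n a+a≤n = *-cancelˡ-<′ 0≤2 (begin-strict
    fromℤ (+ 2) * (K * ⅔ ^ n)
      ≤⟨ *-monoˡ-≤′ 0≤2 (*-monoʳ-≤′ (^-nonNeg n 0≤⅔) (proj₂ (ceilingℕ K))) ⟩
    fromℤ (+ 2) * (fromℤ (+ a) * ⅔ ^ n)
      ≡⟨ solve 2 (λ a t → con (fromℤ (+ 2)) :* (a :* t) := (a :+ a) :* t) refl (fromℤ (+ a)) (⅔ ^ n) ⟩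
    (fromℤ (+ a) + fromℤ (+ a)) * ⅔ ^ n
      ≡⟨ cong (_* ⅔ ^ n) (fromℤ-+ (+ a) (+ a)) ⟩
    fromℤ (+ (a ℕ.+ a)) * ⅔ ^ n
      <⟨ *-monoˡ-<-pos (⅔ ^ n) {{ℚ.positive (^-pos n 0<⅔)}} a+a<n+2 ⟩
    fromℤ (+ (n ℕ.+ 2)) * ⅔ ^ n
      ≤⟨ bernoulli-⅔ n ⟩
    fromℤ (+ 2) * 1ℚ ∎)
    where
    open ≤-Reasoning
    a+a<n+2 : fromℤ (+ (a ℕ.+ a)) < fromℤ (+ (n ℕ.+ 2))
    a+a<n+2 = fromℤ-mono-< (ℤ.+<+ (ℕₚ.≤-<-trans a+a≤n (ℕₚ.m<m+n n (s≤s z≤n))))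

⅓^n-eventually-below-½^n : ∀ K → ∃[ N ] ∀ n → N ℕ.≤ n → K * ⅓ ^ n < ½ ^ n
⅓^n-eventually-below-½^n K = proj₁ (⅔^n-eventually-small K) , λ n N≤n → begin-strict
  K * ⅓ ^ n
    ≡⟨ cong (K *_) (^-distrib-* ½ ⅔ n) ⟩
  K * (½ ^ n * ⅔ ^ n)
    ≡⟨ solve 3 (λ K h t → K :* (h :* t) := h :* (K :* t)) refl K (½ ^ n) (⅔ ^ n) ⟩
  ½ ^ n * (K * ⅔ ^ n)
    <⟨ *-monoˡ-<′ (^-pos n (toWitness {a? = 0ℚ <? ½} _)) (proj₂ (⅔^n-eventually-small K) n N≤n) ⟩
  ½ ^ n * 1ℚ
    ≡⟨ *-identityʳ (½ ^ n) ⟩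
  ½ ^ n ∎
  where open ≤-Reasoning

-- LimsupLess (partial r) q is Defs' ValLess r q.
LimsupLess : (ℕ → ℚ) → ℚ → Set
LimsupLess f q = ∃[ ε ] (0ℚ < ε × ∃[ N ] ∀ j → N ℕ.≤ j → f j + ε ≤ q)

LimsupLess-mono : ∀ {f q q′} → q ≤ q′ → LimsupLess f q → LimsupLess f q′
LimsupLess-mono q≤q′ (ε , 0<ε , N , below) = ε , 0<ε , N , λ j N≤j → ≤-trans (below j N≤j) q≤q′

LimsupLess-transfer : ∀ {f g q α β} m n → 0ℚ < β →
                      (∀ j → g (m ℕ.+ j) ≤ α + β * f (n ℕ.+ j)) →
                      LimsupLess f q → LimsupLess g (α + β * q)
LimsupLess-transfer {f} {g} {q} {α} {β} m n 0<β g≤ (ε , 0<ε , N , below) =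
  β * ε , *-pos 0<β 0<ε , m ℕ.+ N , bound
  where
  open ≤-Reasoning
  bound : ∀ j → m ℕ.+ N ℕ.≤ j → g j + β * ε ≤ α + β * q
  bound j m+N≤j with ℕₚ.m≤n⇒∃[o]m+o≡n m+N≤j
  ... | o , refl = begin
    g (m ℕ.+ N ℕ.+ o) + β * ε
      ≡⟨ cong (λ i → g i + β * ε) (ℕₚ.+-assoc m N o) ⟩
    g (m ℕ.+ (N ℕ.+ o)) + β * ε
      ≤⟨ +-monoˡ-≤ (β * ε) (g≤ (N ℕ.+ o)) ⟩
    α + β * f k + β * ε
      ≡⟨ solve 4 (λ α β x ε → α :+ β :* x :+ β :* ε := α :+ β :* (x :+ ε)) refl α β (f k) ε ⟩
    α + β * (f k + ε)
      ≤⟨ +-monoʳ-≤ α (*-monoˡ-≤′ (<⇒≤ 0<β) (below k N≤k)) ⟩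
    α + β * q ∎
    where
    k = n ℕ.+ (N ℕ.+ o)
    N≤k = ℕₚ.≤-trans (ℕₚ.m≤m+n N o) (ℕₚ.m≤n+m (N ℕ.+ o) n)

LimsupLess⇔-eventually-constant : ∀ {f V q} N → (∀ j → N ℕ.≤ j → f j ≡ V) → LimsupLess f q ⇔ V < q
LimsupLess⇔-eventually-constant {f} {V} {q} N f≡V = mk⇔ to from
  where
  to : LimsupLess f q → V < q
  to (ε , 0<ε , N′ , below) = begin-strict
    V               ≡⟨ sym (+-identityʳ V) ⟩
    V + 0ℚ          <⟨ +-monoʳ-< V 0<ε ⟩
    V + ε           ≡⟨ cong (_+ ε) (sym (f≡V (N ℕ.+ N′) (ℕₚ.m≤m+n N N′))) ⟩
    f (N ℕ.+ N′) + ε ≤⟨ below (N ℕ.+ N′) (ℕₚ.m≤n+m N′ N) ⟩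
    q               ∎
    where open ≤-Reasoning
  from : V < q → LimsupLess f q
  from V<q = q - V , 0<q-V , N , λ j N≤j → ≤-reflexive (begin
    f j + (q - V)  ≡⟨ cong (_+ (q - V)) (f≡V j N≤j) ⟩
    V + (q - V)    ≡⟨ solve 2 (λ V q → V :+ (q :- V) := q) refl V q ⟩
    q              ∎)
    where
    open ≡-Reasoning
    0<q-V : 0ℚ < q - V
    0<q-V = subst (_< q - V) (+-inverseʳ V) (+-monoˡ-< (- V) V<q)

shift : ∀ {A : Set} → ℕ → (ℕ → A) → ℕ → A
shift n f i = f (n ℕ.+ i)

splice : ∀ {A : Set} → (ℕ → A) → ℕ → (ℕ → A) → ℕ → A
splice u zero    v i       = v i
splice u (suc n) v zero    = u 0
splice u (suc n) v (suc i) = splice (shift 1 u) n v i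

splice-+ : ∀ {A : Set} (u : ℕ → A) n v i → splice u n v (n ℕ.+ i) ≡ v i
splice-+ u zero    v i = refl
splice-+ u (suc n) v i = splice-+ (shift 1 u) n v i

splice-< : ∀ {A : Set} (u : ℕ → A) n v {i} → i ℕ.< n → splice u n v i ≡ u i
splice-< u (suc n) v {zero}  _         = refl
splice-< u (suc n) v {suc i} (s≤s i<n) = splice-< (shift 1 u) n v i<n

splice-≤ : ∀ {A : Set} (u : ℕ → A) n v {i} → v 0 ≡ u n → i ℕ.≤ n → splice u n v i ≡ u i
splice-≤ u zero    v {zero}  v0≡un _         = v0≡un
splice-≤ u (suc n) v {zero}  _     _         = refl
splice-≤ u (suc n) v {suc i} v0≡un (s≤s i≤n) = splice-≤ (shift 1 u) n v v0≡un i≤n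

-- Defs' disc and partial, for an arbitrary weight sequence g and discount sequence d.
discountFactor : (ℕ → ℚ) → ℕ → ℚ
discountFactor d zero    = 1ℚ
discountFactor d (suc n) = discountFactor d n * d n

discountedSum : (ℕ → ℚ) → (ℕ → ℚ) → ℕ → ℚ
discountedSum g d zero    = 0ℚ
discountedSum g d (suc n) = discountedSum g d n + g n * discountFactor d n

discountFactor-+ : ∀ d n j → discountFactor d (n ℕ.+ j) ≡ discountFactor d n * discountFactor (shift n d) j
discountFactor-+ d n zero    rewrite ℕₚ.+-identityʳ n = sym (*-identityʳ _)
discountFactor-+ d n (suc j) rewrite ℕₚ.+-suc n j =
  trans (cong (_* d (n ℕ.+ j)) (discountFactor-+ d n j))
        (*-assoc (discountFactor d n) (discountFactor (shift n d) j) (d (n ℕ.+ j)))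

discountedSum-+ : ∀ g d n j → discountedSum g d (n ℕ.+ j) ≡
                  discountedSum g d n + discountFactor d n * discountedSum (shift n g) (shift n d) j
discountedSum-+ g d n zero    rewrite ℕₚ.+-identityʳ n =
  sym (trans (cong (_+_ (discountedSum g d n)) (*-zeroʳ (discountFactor d n))) (+-identityʳ _))
discountedSum-+ g d n (suc j) rewrite ℕₚ.+-suc n j = begin
  discountedSum g d (n ℕ.+ j) + g (n ℕ.+ j) * discountFactor d (n ℕ.+ j)
    ≡⟨ cong₂ (λ s f → s + g (n ℕ.+ j) * f) (discountedSum-+ g d n j) (discountFactor-+ d n j) ⟩
  (S n + F * S′) + g (n ℕ.+ j) * (F * F′)
    ≡⟨ solve 5 (λ s F s′ x F′ → (s :+ F :* s′) :+ x :* (F :* F′) := s :+ F :* (s′ :+ x :* F′))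
               refl (S n) F S′ (g (n ℕ.+ j)) F′ ⟩
  S n + F * (S′ + g (n ℕ.+ j) * F′) ∎
  where
  open ≡-Reasoning
  S = discountedSum g d
  F = discountFactor d n
  F′ = discountFactor (shift n d) j
  S′ = discountedSum (shift n g) (shift n d) j

discountedSum-suc : ∀ g d j → discountedSum g d (suc j) ≡ g 0 + d 0 * discountedSum (shift 1 g) (shift 1 d) j
discountedSum-suc g d j = trans (discountedSum-+ g d 1 j)
  (solve 3 (λ x y s → con 0ℚ :+ x :* con 1ℚ :+ con 1ℚ :* y :* s := x :+ y :* s) refl (g 0) (d 0)
           (discountedSum (shift 1 g) (shift 1 d) j))

discountFactor-cong : ∀ {d d′} n → (∀ i → i ℕ.< n → d i ≡ d′ i) → discountFactor d n ≡ discountFactor d′ n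
discountFactor-cong zero    _    = refl
discountFactor-cong (suc n) d≡d′ =
  cong₂ _*_ (discountFactor-cong n (λ i i<n → d≡d′ i (ℕₚ.m<n⇒m<1+n i<n))) (d≡d′ n (ℕₚ.n<1+n n))

discountedSum-cong : ∀ {g g′ d d′} n → (∀ i → i ℕ.< n → g i ≡ g′ i) → (∀ i → i ℕ.< n → d i ≡ d′ i) →
                     discountedSum g d n ≡ discountedSum g′ d′ n
discountedSum-cong zero    _    _    = refl
discountedSum-cong (suc n) g≡g′ d≡d′ =
  cong₂ _+_ (discountedSum-cong n (below g≡g′) (below d≡d′))
            (cong₂ _*_ (g≡g′ n (ℕₚ.n<1+n n)) (discountFactor-cong n (below d≡d′)))
  where
  below : ∀ {h h′ : ℕ → ℚ} → (∀ i → i ℕ.< suc n → h i ≡ h′ i) → ∀ i → i ℕ.< n → h i ≡ h′ i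
  below h≡h′ i i<n = h≡h′ i (ℕₚ.m<n⇒m<1+n i<n)

discountFactor-const : ∀ {d} {μ} n → (∀ i → i ℕ.< n → d i ≡ μ) → discountFactor d n ≡ μ ^ n
discountFactor-const zero    _   = refl
discountFactor-const {μ = μ} (suc n) d≡μ =
  trans (cong₂ _*_ (discountFactor-const n (λ i i<n → d≡μ i (ℕₚ.m<n⇒m<1+n i<n))) (d≡μ n (ℕₚ.n<1+n n)))
        (*-comm (μ ^ n) μ)

discountedSum-zero : ∀ {g d} n → (∀ i → i ℕ.< n → g i ≡ 0ℚ) → discountedSum g d n ≡ 0ℚ
discountedSum-zero zero    _   = refl
discountedSum-zero {g} {d} (suc n) g≡0 = begin
  discountedSum g d n + g n * discountFactor d n
    ≡⟨ cong₂ (λ s x → s + x * discountFactor d n)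
             (discountedSum-zero n (λ i i<n → g≡0 i (ℕₚ.m<n⇒m<1+n i<n))) (g≡0 n (ℕₚ.n<1+n n)) ⟩
  0ℚ + 0ℚ * discountFactor d n
    ≡⟨ trans (+-identityˡ (0ℚ * discountFactor d n)) (*-zeroˡ (discountFactor d n)) ⟩
  0ℚ ∎
  where open ≡-Reasoning

∣discountedSum∣≤ : ∀ {g d M} n → 0ℚ ≤ M → (∀ i → ∣ g i ∣ ≤ M) → (∀ i → 0ℚ ≤ d i) → (∀ i → d i ≤ ½) →
                   ∣ discountedSum g d n ∣ ≤ M + M
∣discountedSum∣≤ zero 0≤M _ _ _ = +-mono-≤ 0≤M 0≤M
∣discountedSum∣≤ {g} {d} {M} (suc n) 0≤M ∣g∣≤M 0≤d d≤½ = begin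
  ∣ discountedSum g d (suc n) ∣
    ≡⟨ cong ∣_∣ (discountedSum-suc g d n) ⟩
  ∣ g 0 + d 0 * S ∣
    ≤⟨ ∣p+q∣≤∣p∣+∣q∣ (g 0) (d 0 * S) ⟩
  ∣ g 0 ∣ + ∣ d 0 * S ∣
    ≡⟨ cong (_+_ ∣ g 0 ∣) (trans (∣p*q∣≡∣p∣*∣q∣ (d 0) S) (cong (_* ∣ S ∣) (0≤p⇒∣p∣≡p (0≤d 0)))) ⟩
  ∣ g 0 ∣ + d 0 * ∣ S ∣
    ≤⟨ +-mono-≤ (∣g∣≤M 0) (≤-trans (*-monoʳ-≤′ (0≤∣p∣ S) (d≤½ 0))
                                   (*-monoˡ-≤′ (toWitness {a? = 0ℚ ≤? ½} _) ∣S∣≤)) ⟩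
  M + ½ * (M + M)
    ≡⟨ solve 1 (λ M → M :+ con ½ :* (M :+ M) := M :+ M) refl M ⟩
  M + M ∎
  where
  open ≤-Reasoning
  S = discountedSum (shift 1 g) (shift 1 d) n
  ∣S∣≤ = ∣discountedSum∣≤ n 0≤M (∣g∣≤M ∘ suc) (0≤d ∘ suc) (d≤½ ∘ suc)

discountedSum-lattice : ∀ {g d D L μ} n → IsInteger L → L * μ ≡ 1ℚ → (∀ i → i ℕ.< n → d i ≡ μ) →
                        (∀ i → IsInteger (D * g i)) → IsInteger (D * L ^ n * discountedSum g d n)
discountedSum-lattice {D = D} zero _ _ _ _ = + 0 , *-zeroʳ (D * 1ℚ)
discountedSum-lattice {g} {d} {D} {L} {μ} (suc n) L∈ℤ Lμ≡1 d≡μ Dg∈ℤ =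
  subst IsInteger (sym eq)
    (isInteger-+ (isInteger-* L∈ℤ (discountedSum-lattice {D = D} n L∈ℤ Lμ≡1 d≡μ′ Dg∈ℤ))
                 (isInteger-* (isInteger-* L∈ℤ (Dg∈ℤ n)) (+ 1 , Lⁿ*F≡1)))
  where
  d≡μ′ : ∀ i → i ℕ.< n → d i ≡ μ
  d≡μ′ i i<n = d≡μ i (ℕₚ.m<n⇒m<1+n i<n)
  S = discountedSum g d n
  F = discountFactor d n
  Lⁿ*F≡1 : L ^ n * F ≡ 1ℚ
  Lⁿ*F≡1 = trans (cong (L ^ n *_) (discountFactor-const n d≡μ′)) (^-inverse n Lμ≡1)
  eq : D * (L * L ^ n) * (S + g n * F) ≡ L * (D * L ^ n * S) + L * (D * g n) * (L ^ n * F)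
  eq = solve 6 (λ D L Lⁿ S x F → D :* (L :* Lⁿ) :* (S :+ x :* F) := L :* (D :* Lⁿ :* S) :+ L :* (D :* x) :* (Lⁿ :* F))
             refl D L (L ^ n) S (g n) F

∀∷⇒∀snoc : ∀ {k} {P : List (Fin k) → Set} → (∀ σ ws → P (σ ∷ ws)) → ∀ u σ → P (u ++ σ ∷ [])
∀∷⇒∀snoc P∷ []      σ = P∷ σ []
∀∷⇒∀snoc P∷ (x ∷ u) σ = P∷ x (u ++ σ ∷ [])

module Automaton {k} (X : NMDA k) where
  open NMDA X

  Transition : Set
  Transition = Fin m × Fin k × Fin m

  transition : (ℕ → Fin k) → (ℕ → Fin m) → ℕ → Transition
  transition w s i = s i , w i , s (suc i)

  IsTransition : Transition → Set
  IsTransition (p , σ , q) = T (δ p σ q)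

  weight discount : Transition → ℚ
  weight   (p , σ , q) = γ p σ q
  discount (p , σ , q) = ρ⁻¹ p σ q

  Valid : (ℕ → Fin k) → (ℕ → Fin m) → Set
  Valid w s = ∀ i → IsTransition (transition w s i)

  value : (ℕ → Fin k) → (ℕ → Fin m) → ℕ → ℚ
  value w s = discountedSum (weight ∘ transition w s) (discount ∘ transition w s)

  partial≡value : ∀ {w} (r : IRun w) n → partial r n ≡ value w (IRun.st r) n
  partial≡value {w} r n = proj₂ (disc∧partial n)
    where
    τ = transition w (IRun.st r)
    disc∧partial : ∀ n → disc r n ≡ discountFactor (discount ∘ τ) n × partial r n ≡ value w (IRun.st r) n
    disc∧partial zero    = refl , refl
    disc∧partial (suc n) = cong (_* discount (τ n)) (proj₁ (disc∧partial n))
                         , cong₂ (λ x y → x + weight (τ n) * y) (proj₂ (disc∧partial n)) (proj₁ (disc∧partial n))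

  value-cong : ∀ {w w′ s s′} n → (∀ i → i ℕ.< n → transition w′ s′ i ≡ transition w s i) →
               value w′ s′ n ≡ value w s n
  value-cong n τ≡ = discountedSum-cong n (λ i i<n → cong weight (τ≡ i i<n)) (λ i i<n → cong discount (τ≡ i i<n))

  value-+ : ∀ {w s v t} n j → (∀ j → transition w s (n ℕ.+ j) ≡ transition v t j) →
            value w s (n ℕ.+ j) ≡ value w s n + discountFactor (discount ∘ transition w s) n * value v t j
  value-+ {w} {s} {v} {t} n j τ≡ = trans (discountedSum-+ _ _ n j)
    (cong (λ x → value w s n + discountFactor (discount ∘ transition w s) n * x)
          (discountedSum-cong j (λ i _ → cong weight (τ≡ i)) (λ i _ → cong discount (τ≡ i))))

  transition-shift : ∀ {w v} s n → (∀ j → w (n ℕ.+ j) ≡ v j) →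
                     ∀ j → transition w s (n ℕ.+ j) ≡ transition v (shift n s) j
  transition-shift s n w≡v j = cong₂ _,_ refl (cong₂ _,_ (w≡v j) (cong s (sym (ℕₚ.+-suc n j))))

  transition-splice-< : ∀ {w w′ s t} n → t 0 ≡ s n → (∀ i → i ℕ.< n → w′ i ≡ w i) →
                        ∀ i → i ℕ.< n → transition w′ (splice s n t) i ≡ transition w s i
  transition-splice-< {s = s} {t} n t0≡sn w′≡w i i<n =
    cong₂ _,_ (splice-≤ s n t t0≡sn (ℕₚ.<⇒≤ i<n)) (cong₂ _,_ (w′≡w i i<n) (splice-≤ s n t t0≡sn i<n))

  transition-splice-+ : ∀ {w′ v s t} n → (∀ j → w′ (n ℕ.+ j) ≡ v j) →
                        ∀ j → transition w′ (splice s n t) (n ℕ.+ j) ≡ transition v t j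
  transition-splice-+ {s = s} {t} n w′≡v j =
    cong₂ _,_ (splice-+ s n t j)
              (cong₂ _,_ (w′≡v j) (trans (cong (splice s n t) (sym (ℕₚ.+-suc n j))) (splice-+ s n t (suc j))))

  valid-shift : ∀ {w v s} n → Valid w s → (∀ j → w (n ℕ.+ j) ≡ v j) → Valid v (shift n s)
  valid-shift {w} {s = s} n valid w≡v j = subst IsTransition (transition-shift {w} s n w≡v j) (valid (n ℕ.+ j))

  valid-splice : ∀ {w w′ v s t} n → Valid w s → Valid v t → t 0 ≡ s n →
                 (∀ i → i ℕ.< n → w′ i ≡ w i) → (∀ j → w′ (n ℕ.+ j) ≡ v j) → Valid w′ (splice s n t)
  valid-splice {w′ = w′} n valid-s valid-t t0≡sn w′≡w w′≡v i with i ℕ.<? n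
  ... | yes i<n = subst IsTransition (sym (transition-splice-< n t0≡sn w′≡w i i<n)) (valid-s i)
  ... | no i≮n with ℕₚ.m≤n⇒∃[o]m+o≡n (ℕₚ.≮⇒≥ i≮n)
  ...   | o , refl = subst IsTransition (sym (transition-splice-+ {w′} n w′≡v o)) (valid-t o)

  spliceRun : ∀ {w w′ v} n (r : IRun w) (t : ℕ → Fin m) → Valid v t → t 0 ≡ IRun.st r n →
              (∀ i → i ℕ.< n → w′ i ≡ w i) → (∀ j → w′ (n ℕ.+ j) ≡ v j) → IRun w′
  spliceRun n r t valid-t t0≡sn w′≡w w′≡v = record
    { st      = splice (IRun.st r) n t
    ; st-init = subst (T ∘ ι) (sym (splice-≤ (IRun.st r) n t t0≡sn z≤n)) (IRun.st-init r)
    ; st-step = valid-splice n (IRun.st-step r) valid-t t0≡sn w′≡w w′≡v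
    }

  pathFrom : (ℕ → Fin k) → Fin m → ℕ → Fin m
  pathFrom w p zero    = p
  pathFrom w p (suc i) = proj₁ (complete (pathFrom w p i) (w i))

  valid-pathFrom : ∀ w p → Valid w (pathFrom w p)
  valid-pathFrom w p i = proj₂ (complete (pathFrom w p i) (w i))

  weightBound : ∃[ M ] (0ℚ ≤ M × ∀ p σ q → ∣ γ p σ q ∣ ≤ M)
  weightBound = proj₁ bound₁ , proj₁ (proj₂ bound₁) , λ p σ q →
    ≤-trans (proj₂ (proj₂ (bound₃ p σ)) q) (≤-trans (proj₂ (proj₂ (bound₂ p)) σ) (proj₂ (proj₂ bound₁) p))
    where
    bound₃ = λ p σ → finite-upperBound m (λ q → ∣ γ p σ q ∣)
    bound₂ = λ p → finite-upperBound k (λ σ → proj₁ (bound₃ p σ))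
    bound₁  = finite-upperBound m (λ p → proj₁ (bound₂ p))

  commonDenominator : ∃[ D ] (0ℚ < D × ∀ p σ q → IsInteger (D * γ p σ q))
  commonDenominator = fromℤ (+ proj₁ mult₁) , fromℤ-mono-< (ℤ.+<+ (proj₁ (proj₂ mult₁))) , λ p σ q →
    isInteger-denominator-multiple (γ p σ q)
      (∣-trans (proj₂ (proj₂ (mult₃ p σ)) q) (∣-trans (proj₂ (proj₂ (mult₂ p)) σ) (proj₂ (proj₂ mult₁) p)))
    where
    mult₃ = λ p σ → finite-commonMultiple m (λ q → ↧ₙ γ p σ q) (λ q → 0<↧ₙ (γ p σ q))
    mult₂ = λ p → finite-commonMultiple k (λ σ → proj₁ (mult₃ p σ)) (λ σ → proj₁ (proj₂ (mult₃ p σ)))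
    mult₁  = finite-commonMultiple m (λ p → proj₁ (mult₂ p)) (λ p → proj₁ (proj₂ (mult₂ p)))

  IsInfValue-≤ : ∀ {w w′ x y} E → IsInfValue w x → IsInfValue w′ y →
                 (∀ p → T (ι p) → (r : FRun p w′) → ∃[ r′ ] fval {p} {w} r′ ≤ fval r + E) → x ≤ y + E
  IsInfValue-≤ {x = x} {y} E (x≤runs , _) (_ , y-greatest) transfer =
    subst (_≤ y + E) (solve 2 (λ x E → x :- E :+ E := x) refl x E) (+-monoˡ-≤ E (y-greatest (x - E) lowerBound))
    where
    lowerBound : ∀ p → T (ι p) → (r : FRun p _) → x - E ≤ fval r
    lowerBound p ιp r = subst (x - E ≤_) (solve 2 (λ f E → f :+ E :- E := f) refl (fval r) E)
      (+-monoˡ-≤ (- E) (≤-trans (x≤runs p ιp (proj₁ (transfer p ιp r))) (proj₂ (transfer p ιp r))))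

  IsInfValue-const : ∀ {w x v p} → T (ι p) → FRun p w → (∀ {p} (r : FRun p w) → fval r ≡ v) →
                     IsInfValue w x → x ≡ v
  IsInfValue-const {v = v} {p} ιp r fval≡v (x≤runs , x-greatest) =
    ≤-antisym (≤-trans (x≤runs p ιp r) (≤-reflexive (fval≡v r)))
              (x-greatest v (λ _ _ r → ≤-reflexive (sym (fval≡v r))))

  IsInfValue-lattice : ∀ {w x S} → 0ℚ < S → (∀ p → T (ι p) → (r : FRun p w) → IsInteger (S * fval r)) →
                       IsInfValue w x → 0ℚ < x → 1ℚ ≤ S * x
  IsInfValue-lattice {x = x} {S} 0<S integral (x≤runs , x-greatest) 0<x =
    subst (_≤ S * x) S*S⁻¹≡1 (*-monoˡ-≤′ (<⇒≤ 0<S) (x-greatest S⁻¹ S⁻¹≤runs))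
    where
    instance _ = pos⇒nonZero S {{ℚ.positive 0<S}}
    S⁻¹ = 1/ S
    S*S⁻¹≡1 = *-inverseʳ S
    S⁻¹≤runs : ∀ p → T (ι p) → (r : FRun p _) → S⁻¹ ≤ fval r
    S⁻¹≤runs p ιp r = *-cancelˡ-≤′ 0<S (begin
      S * S⁻¹    ≡⟨ S*S⁻¹≡1 ⟩
      1ℚ         ≤⟨ isInteger-pos⇒1≤ (integral p ιp r) (*-pos 0<S (<-≤-trans 0<x (x≤runs p ιp r))) ⟩
      S * fval r ∎)
      where open ≤-Reasoning

-- NMDAs with a single integral discount factor

inv>1-cong : ∀ {r s} (r≡s : r ≡ s) p q → inv>1 r p ≡ inv>1 s q
inv>1-cong {r} refl p q = cong (inv>1 r) (<-irrelevant p q)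

module UniformDiscount {k} (B : NMDA k) (l : ℕ) (2≤l : 2 ℕ.≤ l)
                       (ρ≡l : ∀ p σ q → T (NMDA.δ B p σ q) → NMDA.ρ B p σ q ≡ ℕtoℚ l) where
  open NMDA B
  open Automaton B

  L : ℚ
  L = ℕtoℚ l

  n≤l⇒n≤L : ∀ {n} → n ℕ.≤ l → fromℤ (+ n) ≤ L
  n≤l⇒n≤L n≤l = subst (_ ≤_) (sym (/1≡fromℤ (+ l))) (fromℤ-mono-≤ (ℤ.+≤+ n≤l))

  1<L : 1ℚ < L
  1<L = <-≤-trans (toWitness {a? = 1ℚ <? fromℤ (+ 2)} _) (n≤l⇒n≤L 2≤l)

  0<L : 0ℚ < L
  0<L = <-trans (toWitness {a? = 0ℚ <? 1ℚ} _) 1<L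

  μ : ℚ
  μ = inv>1 L 1<L

  L*μ≡1 : L * μ ≡ 1ℚ
  L*μ≡1 = *-inverseʳ L {{pos⇒nonZero L {{ℚ.positive 0<L}}}}

  0≤μ : 0ℚ ≤ μ
  0≤μ = *-cancelˡ-≤′ 0<L (subst₂ _≤_ (sym (*-zeroʳ L)) (sym L*μ≡1) (toWitness {a? = 0ℚ ≤? 1ℚ} _))

  μ≤ : ∀ c → 1ℚ ≤ L * c → μ ≤ c
  μ≤ c 1≤Lc = *-cancelˡ-≤′ 0<L (subst (_≤ L * c) (sym L*μ≡1) 1≤Lc)

  μ≤½ : μ ≤ ½
  μ≤½ = μ≤ ½ (*-monoʳ-≤′ (toWitness {a? = 0ℚ ≤? ½} _) (n≤l⇒n≤L 2≤l))

  μ≤⅓ : 3 ℕ.≤ l → μ ≤ ⅓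
  μ≤⅓ 3≤l = μ≤ ⅓ (*-monoʳ-≤′ (toWitness {a? = 0ℚ ≤? ⅓} _) (n≤l⇒n≤L 3≤l))

  ρ⁻¹≡μ : ∀ {p σ q} → T (δ p σ q) → ρ⁻¹ p σ q ≡ μ
  ρ⁻¹≡μ {p} {σ} {q} t = inv>1-cong (ρ≡l p σ q t) (ρ>1 p σ q) 1<L

  M : ℚ
  M = proj₁ weightBound

  0≤M : 0ℚ ≤ M
  0≤M = proj₁ (proj₂ weightBound)

  ∣γ∣≤M : ∀ p σ q → ∣ γ p σ q ∣ ≤ M
  ∣γ∣≤M = proj₂ (proj₂ weightBound)

  D : ℚ
  D = proj₁ commonDenominator

  0<D : 0ℚ < D
  0<D = proj₁ (proj₂ commonDenominator)

  Dγ∈ℤ : ∀ p σ q → IsInteger (D * γ p σ q)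
  Dγ∈ℤ = proj₂ (proj₂ commonDenominator)

  fval-step : ∀ {p σ q ws} (t : T (δ p σ q)) (r : FRun q ws) → fval (step q t r) ≡ γ p σ q + μ * fval r
  fval-step {p} {σ} {q} t r = cong (λ d → γ p σ q + d * fval r) (ρ⁻¹≡μ t)

  swapLastLetter : ∀ {p} u σ σ′ (r : FRun p (u ++ σ ∷ [])) →
                   ∃[ r′ ] fval {p} {u ++ σ′ ∷ []} r′ ≤ fval r + μ ^ length u * (M + M)
  swapLastLetter {p} [] σ σ′ (step q t (done .q)) = step q′ t′ (done q′) , (begin
    fval (step q′ t′ (done q′))
      ≡⟨ fval-step t′ (done q′) ⟩
    γ p σ′ q′ + μ * 0ℚ
      ≡⟨ solve 2 (λ g μ → g :+ μ :* con 0ℚ := g) refl (γ p σ′ q′) μ ⟩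
    γ p σ′ q′
      ≤⟨ x≤y+∣x∣+∣y∣ (γ p σ′ q′) (γ p σ q) ⟩
    γ p σ q + (∣ γ p σ′ q′ ∣ + ∣ γ p σ q ∣)
      ≤⟨ +-monoʳ-≤ (γ p σ q) (+-mono-≤ (∣γ∣≤M p σ′ q′) (∣γ∣≤M p σ q)) ⟩
    γ p σ q + (M + M)
      ≡⟨ solve 3 (λ g μ K → g :+ K := g :+ μ :* con 0ℚ :+ con 1ℚ :* K) refl (γ p σ q) μ (M + M) ⟩
    γ p σ q + μ * 0ℚ + 1ℚ * (M + M)
      ≡⟨ cong (_+ 1ℚ * (M + M)) (sym (fval-step t (done q))) ⟩
    fval (step q t (done q)) + 1ℚ * (M + M) ∎)
    where
    open ≤-Reasoning
    q′ = proj₁ (complete p σ′)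
    t′ = proj₂ (complete p σ′)
  swapLastLetter {p} (x ∷ u) σ σ′ (step q t r) = step q t r′ , (begin
    fval (step q t r′)
      ≡⟨ fval-step t r′ ⟩
    γ p x q + μ * fval r′
      ≤⟨ +-monoʳ-≤ (γ p x q) (*-monoˡ-≤′ 0≤μ r′≤) ⟩
    γ p x q + μ * (fval r + μ ^ length u * (M + M))
      ≡⟨ solve 5 (λ g μ f μⁿ K → g :+ μ :* (f :+ μⁿ :* K) := g :+ μ :* f :+ μ :* μⁿ :* K)
                 refl (γ p x q) μ (fval r) (μ ^ length u) (M + M) ⟩
    γ p x q + μ * fval r + μ * μ ^ length u * (M + M)
      ≡⟨ cong (_+ μ * μ ^ length u * (M + M)) (sym (fval-step t r)) ⟩
    fval (step q t r) + μ ^ length (x ∷ u) * (M + M) ∎)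
    where
    open ≤-Reasoning
    r′ = proj₁ (swapLastLetter u σ σ′ r)
    r′≤ = proj₂ (swapLastLetter u σ σ′ r)

  fval-lattice : ∀ {p w} (r : FRun p w) → IsInteger (D * L ^ length w * fval r)
  fval-lattice (done _) = + 0 , *-zeroʳ (D * 1ℚ)
  fval-lattice {p} (step {σ = σ} {ws} q t r) = subst IsInteger (sym eq)
    (isInteger-+ (isInteger-* (isInteger-^ (suc (length ws)) (isInteger-ℕ l)) (Dγ∈ℤ p σ q))
                 (isInteger-* (+ 1 , L*μ≡1) (fval-lattice r)))
    where
    Lⁿ = L ^ length ws
    eq : D * (L * Lⁿ) * fval (step q t r) ≡ L * Lⁿ * (D * γ p σ q) + L * μ * (D * Lⁿ * fval r)
    eq = trans (cong (D * (L * Lⁿ) *_) (fval-step t r))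
               (solve 6 (λ D L Lⁿ g μ f → D :* (L :* Lⁿ) :* (g :+ μ :* f) := L :* Lⁿ :* (D :* g) :+ L :* μ :* (D :* Lⁿ :* f))
                      refl D L Lⁿ (γ p σ q) μ (fval r))

  discount-valid : ∀ {w s} → Valid w s → ∀ i → discount (transition w s i) ≡ μ
  discount-valid valid i = ρ⁻¹≡μ (valid i)

  ∣value∣≤ : ∀ {w s} → Valid w s → ∀ n → ∣ value w s n ∣ ≤ M + M
  ∣value∣≤ valid n = ∣discountedSum∣≤ n 0≤M (λ _ → ∣γ∣≤M _ _ _)
    (λ i → subst (0ℚ ≤_) (sym (discount-valid valid i)) 0≤μ)
    (λ i → subst (_≤ ½) (sym (discount-valid valid i)) μ≤½)

  value-lattice : ∀ {w s} → Valid w s → ∀ n → IsInteger (D * L ^ n * value w s n)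
  value-lattice {w} {s} valid n = discountedSum-lattice {D = D} n (isInteger-ℕ l) L*μ≡1 (λ i _ → discount-valid valid i)
                                    (λ i → Dγ∈ℤ (s i) (w i) (s (suc i)))

  value-splice : ∀ {w w′ s s′ v t} n → Valid w s →
                 (∀ i → i ℕ.< n → transition w′ s′ i ≡ transition w s i) →
                 (∀ j → transition w′ s′ (n ℕ.+ j) ≡ transition v t j) →
                 ∀ j → value w′ s′ (n ℕ.+ j) ≡ value w s n + μ ^ n * value v t j
  value-splice {v = v} {t} n valid prefix≡ suffix≡ j = trans (value-+ n j suffix≡)
    (cong₂ (λ x y → x + y * value v t j) (value-cong n prefix≡)
           (discountFactor-const n (λ i i<n → trans (cong discount (prefix≡ i i<n)) (discount-valid valid i))))

-- The letter-oriented NMDA 𝒜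

pattern 𝐚 = zero
pattern 𝐛 = suc zero
pattern 𝐜 = suc (suc zero)

Λ : Fin 3 → ℕ
Λ 𝐚 = 2
Λ 𝐛 = 2
Λ 𝐜 = 3

cost : Fin 3 → ℚ
cost 𝐚 = 0ℚ
cost 𝐛 = 1ℚ
cost 𝐜 = 0ℚ

2≤Λ : ∀ σ → 2 ℕ.≤ Λ σ
2≤Λ 𝐚 = s≤s (s≤s z≤n)
2≤Λ 𝐛 = s≤s (s≤s z≤n)
2≤Λ 𝐜 = s≤s (s≤s z≤n)

1<Λ : ∀ σ → 1ℚ < ℕtoℚ (Λ σ)
1<Λ 𝐚 = toWitness {a? = 1ℚ <? ℕtoℚ 2} _
1<Λ 𝐛 = toWitness {a? = 1ℚ <? ℕtoℚ 2} _
1<Λ 𝐜 = toWitness {a? = 1ℚ <? ℕtoℚ 3} _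

𝒜 : NMDA 3
𝒜 = record
  { m        = 1
  ; ι        = λ _ → true
  ; δ        = λ _ _ _ → true
  ; γ        = λ _ σ _ → cost σ
  ; ρ        = λ _ σ _ → ℕtoℚ (Λ σ)
  ; ρ>1      = λ _ σ _ → 1<Λ σ
  ; init-ne  = zero , tt
  ; complete = λ _ _ → zero , tt
  }

𝒜-letterOriented : IsLetterOriented 𝒜
𝒜-letterOriented = (λ _ σ _ _ → Λ σ , refl) , Λ , 2≤Λ , (λ _ _ _ _ → refl)

module A = NMDA 𝒜

ν : Fin 3 → ℚ
ν σ = inv>1 (ℕtoℚ (Λ σ)) (1<Λ σ)

𝒜-fval : ∀ {p} x σ n → cost x ≡ 0ℚ → (r : A.FRun p (replicate n x ++ σ ∷ [])) → A.fval r ≡ ν x ^ n * cost σ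
𝒜-fval x σ zero    _        (A.step _ _ (A.done _)) =
  solve 2 (λ g ν → g :+ ν :* con 0ℚ := con 1ℚ :* g) refl (cost σ) (ν σ)
𝒜-fval x σ (suc n) costx≡0 (A.step _ _ r) = begin
  cost x + ν x * A.fval r
    ≡⟨ cong₂ (λ y z → y + ν x * z) costx≡0 (𝒜-fval x σ n costx≡0 r) ⟩
  0ℚ + ν x * (ν x ^ n * cost σ)
    ≡⟨ solve 3 (λ ν νⁿ g → con 0ℚ :+ ν :* (νⁿ :* g) := ν :* νⁿ :* g) refl (ν x) (ν x ^ n) (cost σ) ⟩
  ν x * ν x ^ n * cost σ ∎
  where open ≡-Reasoning

𝒜-run : ∀ w → A.FRun zero w
𝒜-run []      = A.done zero
𝒜-run (σ ∷ w) = A.step zero tt (𝒜-run w)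

𝒜-value : ∀ {x σ v} n → cost x ≡ 0ℚ → A.IsInfValue (replicate n x ++ σ ∷ []) v → v ≡ ν x ^ n * cost σ
𝒜-value {x} {σ} n costx≡0 = Automaton.IsInfValue-const 𝒜 tt (𝒜-run _) (𝒜-fval x σ n costx≡0)

aω baω : ℕ → Fin 3
aω _ = 𝐚
baω zero    = 𝐛
baω (suc _) = 𝐚

word : Fin 3 → ℕ → ℕ → Fin 3
word x n = splice (λ _ → x) n baω

𝒜-partial : ∀ {w} (r : A.IRun w) n → A.partial r n ≡ discountedSum (cost ∘ w) (ν ∘ w) n
𝒜-partial = Automaton.partial≡value 𝒜

𝒜-partial-aω : ∀ (r : A.IRun aω) n → A.partial r n ≡ 0ℚ
𝒜-partial-aω r n = trans (𝒜-partial r n) (discountedSum-zero n (λ _ _ → refl))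

discountedSum-baω : ∀ o → discountedSum (cost ∘ baω) (ν ∘ baω) (suc o) ≡ 1ℚ
discountedSum-baω o = begin
  discountedSum (cost ∘ baω) (ν ∘ baω) (suc o)
    ≡⟨ discountedSum-suc (cost ∘ baω) (ν ∘ baω) o ⟩
  1ℚ + ½ * discountedSum (λ _ → 0ℚ) (λ _ → ½) o
    ≡⟨ cong (λ y → 1ℚ + ½ * y) (discountedSum-zero o (λ _ _ → refl)) ⟩
  1ℚ + ½ * 0ℚ
    ≡⟨⟩
  1ℚ ∎
  where open ≡-Reasoning

𝒜-partial-word : ∀ x n → cost x ≡ 0ℚ → ∀ (r : A.IRun (word x n)) j → suc n ℕ.≤ j → A.partial r j ≡ ν x ^ n
𝒜-partial-word x n costx≡0 r j n<j with ℕₚ.m≤n⇒∃[o]m+o≡n n<j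
... | o , refl = begin
  A.partial r (suc n ℕ.+ o)
    ≡⟨ trans (cong (A.partial r) (sym (ℕₚ.+-suc n o))) (𝒜-partial r (n ℕ.+ suc o)) ⟩
  discountedSum (cost ∘ w) (ν ∘ w) (n ℕ.+ suc o)
    ≡⟨ discountedSum-+ (cost ∘ w) (ν ∘ w) n (suc o) ⟩
  discountedSum (cost ∘ w) (ν ∘ w) n + discountFactor (ν ∘ w) n * discountedSum (shift n (cost ∘ w)) (shift n (ν ∘ w)) (suc o)
    ≡⟨ cong₂ _+_ (discountedSum-zero n (λ i i<n → trans (cong cost (splice-< _ n baω i<n)) costx≡0))
                 (cong₂ _*_ (discountFactor-const n (λ i i<n → cong ν (splice-< _ n baω i<n)))
                            (trans (discountedSum-cong (suc o) (λ i _ → cong cost (splice-+ _ n baω i))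
                                                               (λ i _ → cong ν (splice-+ _ n baω i)))
                                   (discountedSum-baω o))) ⟩
  0ℚ + ν x ^ n * 1ℚ
    ≡⟨ trans (+-identityˡ (ν x ^ n * 1ℚ)) (*-identityʳ (ν x ^ n)) ⟩
  ν x ^ n ∎
  where
  open ≡-Reasoning
  w = word x n

𝒜-run∞ : ∀ w → A.IRun w
𝒜-run∞ w = record { st = λ _ → zero ; st-init = tt ; st-step = λ _ → tt }

𝒜-InfLess⇔ : ∀ {w V q} N → (∀ (r : A.IRun w) j → N ℕ.≤ j → A.partial r j ≡ V) → A.InfLess w q ⇔ V < q
𝒜-InfLess⇔ {w} N eventually = mk⇔
  (λ (r , r<q) → Equivalence.to (LimsupLess⇔-eventually-constant N (eventually r)) r<q)
  (λ V<q → 𝒜-run∞ w , Equivalence.from (LimsupLess⇔-eventually-constant N (eventually (𝒜-run∞ w))) V<q)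

-- Integral NDAs with discount factor at least 3

module FiniteLargeDiscount (B : NMDA 3) (l : ℕ) (3≤l : 3 ℕ.≤ l)
                           (ρ≡l : ∀ p σ q → T (NMDA.δ B p σ q) → NMDA.ρ B p σ q ≡ ℕtoℚ l) where
  open NMDA B
  open Automaton B
  open UniformDiscount B l (ℕₚ.≤-trans (ℕₚ.n≤1+n 2) 3≤l) ρ≡l

  no-finite-equivalence : ¬ (∀ σ ws → FinEq 𝒜 B (σ ∷ ws))
  no-finite-equivalence equal = <-irrefl refl (begin-strict
    ½ ^ N             ≡⟨ sym (trans (𝒜-value N refl (proj₁ (proj₂ equal-b))) (*-identityʳ (½ ^ N))) ⟩
    proj₁ equal-b     ≤⟨ IsInfValue-≤ E (proj₂ (proj₂ equal-b)) (proj₂ (proj₂ equal-a)) swap ⟩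
    proj₁ equal-a + E ≡⟨ cong (_+ E) (trans (𝒜-value N refl (proj₁ (proj₂ equal-a))) (*-zeroʳ (½ ^ N))) ⟩
    0ℚ + E            ≡⟨ +-identityˡ E ⟩
    μ ^ N * (M + M)   ≤⟨ *-monoʳ-≤′ (+-mono-≤ 0≤M 0≤M) (^-mono-≤ N 0≤μ (μ≤⅓ 3≤l)) ⟩
    ⅓ ^ N * (M + M)   ≡⟨ *-comm (⅓ ^ N) (M + M) ⟩
    (M + M) * ⅓ ^ N   <⟨ proj₂ (⅓^n-eventually-below-½^n (M + M)) N ℕₚ.≤-refl ⟩
    ½ ^ N             ∎)
    where
    open ≤-Reasoning
    N = proj₁ (⅓^n-eventually-below-½^n (M + M))
    E = μ ^ N * (M + M)
    equal-b : FinEq 𝒜 B (replicate N 𝐚 ++ 𝐛 ∷ [])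
    equal-b = ∀∷⇒∀snoc {P = FinEq 𝒜 B} equal (replicate N 𝐚) 𝐛
    equal-a : FinEq 𝒜 B (replicate N 𝐚 ++ 𝐚 ∷ [])
    equal-a = ∀∷⇒∀snoc {P = FinEq 𝒜 B} equal (replicate N 𝐚) 𝐚
    swap : ∀ p → T (ι p) → (r : FRun p (replicate N 𝐚 ++ 𝐚 ∷ [])) →
           ∃[ r′ ] fval {p} {replicate N 𝐚 ++ 𝐛 ∷ []} r′ ≤ fval r + E
    swap p _ r = proj₁ swapped ,
      subst (λ n → fval (proj₁ swapped) ≤ fval r + μ ^ n * (M + M)) (length-replicate N) (proj₂ swapped)
      where swapped = swapLastLetter (replicate N 𝐚) 𝐚 𝐛 r

module InfiniteLargeDiscount (B : NMDA 3) (l : ℕ) (3≤l : 3 ℕ.≤ l)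
                             (ρ≡l : ∀ p σ q → T (NMDA.δ B p σ q) → NMDA.ρ B p σ q ≡ ℕtoℚ l) where
  open NMDA B
  open Automaton B
  open UniformDiscount B l (ℕₚ.≤-trans (ℕₚ.n≤1+n 2) 3≤l) ρ≡l

  K : ℚ
  K = (M + M) + (M + M)

  0≤K : 0ℚ ≤ K
  0≤K = +-mono-≤ (+-mono-≤ 0≤M 0≤M) (+-mono-≤ 0≤M 0≤M)

  module _ (n : ℕ) (S : IRun aω) where
    tail : ℕ → Fin m
    tail = pathFrom baω (IRun.st S n)

    switched : IRun (word 𝐚 n)
    switched = spliceRun n S tail (valid-pathFrom baω (IRun.st S n)) refl
                         (λ i i<n → splice-< aω n baω i<n) (splice-+ aω n baω)

    switched≤ : ∀ j → partial switched (n ℕ.+ j) ≤ μ ^ n * K + 1ℚ * partial S (n ℕ.+ j)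
    switched≤ j = begin
      partial switched (n ℕ.+ j)
        ≡⟨ partial≡value switched (n ℕ.+ j) ⟩
      value (word 𝐚 n) (IRun.st switched) (n ℕ.+ j)
        ≡⟨ value-splice n (IRun.st-step S) (transition-splice-< n refl (λ i i<n → splice-< aω n baω i<n))
                        (transition-splice-+ {word 𝐚 n} n (splice-+ aω n baω)) j ⟩
      P + μ ^ n * T₁
        ≤⟨ +-monoʳ-≤ P (*-monoˡ-≤′ (^-nonNeg n 0≤μ) T₁≤T₀+K) ⟩
      P + μ ^ n * (T₀ + K)
        ≡⟨ solve 4 (λ P μⁿ T K → P :+ μⁿ :* (T :+ K) := μⁿ :* K :+ con 1ℚ :* (P :+ μⁿ :* T)) refl P (μ ^ n) T₀ K ⟩
      μ ^ n * K + 1ℚ * (P + μ ^ n * T₀)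
        ≡⟨ cong (λ z → μ ^ n * K + 1ℚ * z) (sym partial-S) ⟩
      μ ^ n * K + 1ℚ * partial S (n ℕ.+ j) ∎
      where
      open ≤-Reasoning
      P = value aω (IRun.st S) n
      T₁ = value baω tail j
      T₀ = value aω (shift n (IRun.st S)) j
      partial-S : partial S (n ℕ.+ j) ≡ P + μ ^ n * T₀
      partial-S = trans (partial≡value S (n ℕ.+ j))
                        (value-splice n (IRun.st-step S) (λ _ _ → refl)
                                      (transition-shift {aω} (IRun.st S) n (λ _ → refl)) j)
      T₁≤T₀+K : T₁ ≤ T₀ + K
      T₁≤T₀+K = ≤-trans (x≤y+∣x∣+∣y∣ T₁ T₀)
        (+-monoʳ-≤ T₀ (+-mono-≤ (∣value∣≤ (valid-pathFrom baω (IRun.st S n)) j)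
                                (∣value∣≤ (valid-shift {aω} n (IRun.st-step S) (λ _ → refl)) j)))

  no-infinite-equivalence : ¬ (∀ w → InfEq 𝒜 B w)
  no-infinite-equivalence equal = <-irrefl refl (begin-strict
    ½ ^ N
      <⟨ 𝒜-bound ⟩
    μ ^ N * K + 1ℚ * η
      ≤⟨ +-monoˡ-≤ (1ℚ * η) (*-monoʳ-≤′ 0≤K (^-mono-≤ N 0≤μ (μ≤⅓ 3≤l))) ⟩
    ⅓ ^ N * K + 1ℚ * η
      ≡⟨ solve 3 (λ t K h → t :* K :+ con 1ℚ :* (con ½ :* h) := con ½ :* ((K :+ K) :* t) :+ con ½ :* h)
                                                refl (⅓ ^ N) K (½ ^ N) ⟩
    ½ * ((K + K) * ⅓ ^ N) + ½ * ½ ^ N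
      <⟨ +-monoˡ-< (½ * ½ ^ N) (*-monoˡ-<′ 0<½ (proj₂ (⅓^n-eventually-below-½^n (K + K)) N ℕₚ.≤-refl)) ⟩
    ½ * ½ ^ N + ½ * ½ ^ N
      ≡⟨ solve 1 (λ h → con ½ :* h :+ con ½ :* h := h) refl (½ ^ N) ⟩
    ½ ^ N ∎)
    where
    open ≤-Reasoning
    0<½ = toWitness {a? = 0ℚ <? ½} _
    N = proj₁ (⅓^n-eventually-below-½^n (K + K))
    η = ½ * ½ ^ N
    S-below : InfLess aω η
    S-below = proj₁ (equal aω η)
      (Equivalence.from (𝒜-InfLess⇔ 0 (λ r j _ → 𝒜-partial-aω r j)) (*-pos 0<½ (^-pos N 0<½)))
    S = proj₁ S-below
    switched-below : LimsupLess (partial (switched N S)) (μ ^ N * K + 1ℚ * η)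
    switched-below = LimsupLess-transfer {partial S} {partial (switched N S)} {α = μ ^ N * K} N N
                       (toWitness {a? = 0ℚ <? 1ℚ} _) (switched≤ N S) (proj₂ S-below)
    𝒜-bound : ½ ^ N < μ ^ N * K + 1ℚ * η
    𝒜-bound = Equivalence.to (𝒜-InfLess⇔ (suc N) (𝒜-partial-word 𝐚 N refl))
                (proj₂ (equal (word 𝐚 N) _) (switched N S , switched-below))

-- Integral NDAs with discount factor 2

module FiniteDiscountTwo (B : NMDA 3) (ρ≡2 : ∀ p σ q → T (NMDA.δ B p σ q) → NMDA.ρ B p σ q ≡ ℕtoℚ 2) where
  open NMDA B
  open Automaton B
  open UniformDiscount B 2 ℕₚ.≤-refl ρ≡2

  no-finite-equivalence : ¬ (∀ σ ws → FinEq 𝒜 B (σ ∷ ws))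
  no-finite-equivalence equal = <-irrefl refl (begin-strict
    1ℚ
      ≤⟨ IsInfValue-lattice 0<S lattice (proj₂ (proj₂ equal-cb)) 0<x ⟩
    D * L ^ suc N * x
      ≡⟨ cong (D * L ^ suc N *_) (trans x≡ (*-identityʳ (⅓ ^ N))) ⟩
    D * (L * L ^ N) * ⅓ ^ N
      ≡⟨ solve 4 (λ D L Lⁿ t → D :* (L :* Lⁿ) :* t := L :* D :* (Lⁿ :* t)) refl D L (L ^ N) (⅓ ^ N) ⟩
    L * D * (L ^ N * ⅓ ^ N)
      ≡⟨ cong (L * D *_) (sym (^-distrib-* L ⅓ N)) ⟩
    L * D * ⅔ ^ N
      <⟨ proj₂ (⅔^n-eventually-small (L * D)) N ℕₚ.≤-refl ⟩
    1ℚ ∎)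
    where
    open ≤-Reasoning
    N = proj₁ (⅔^n-eventually-small (L * D))
    w = replicate N 𝐜 ++ 𝐛 ∷ []
    equal-cb : FinEq 𝒜 B w
    equal-cb = ∀∷⇒∀snoc {P = FinEq 𝒜 B} equal (replicate N 𝐜) 𝐛
    x = proj₁ equal-cb
    x≡ : x ≡ ⅓ ^ N * 1ℚ
    x≡ = 𝒜-value N refl (proj₁ (proj₂ equal-cb))
    0<x : 0ℚ < x
    0<x = subst (0ℚ <_) (sym x≡) (*-pos (^-pos N (toWitness {a? = 0ℚ <? ⅓} _)) (toWitness {a? = 0ℚ <? 1ℚ} _))
    0<S : 0ℚ < D * L ^ suc N
    0<S = *-pos 0<D (^-pos (suc N) (toWitness {a? = 0ℚ <? L} _))
    length-w : length w ≡ suc N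
    length-w = trans (length-++ (replicate N 𝐜)) (trans (cong (ℕ._+ 1) (length-replicate N)) (ℕₚ.+-comm N 1))
    lattice : ∀ p → T (ι p) → (r : FRun p w) → IsInteger (D * L ^ suc N * fval r)
    lattice p _ r = subst (λ n → IsInteger (D * L ^ n * fval r)) length-w (fval-lattice r)

-- Any c with 1 < c < 3/2 would do in place of ⁵⁄₄: c · ⅔ < 1 keeps the lower end of the window positive.
⁵⁄₄ : ℚ
⁵⁄₄ = + 5 ℚ./ 4

no-integer-in-window : ∀ {D e e′} n n′ → 0ℚ < D → n ℕ.< n′ → D * (⁵⁄₄ * ⅔ ^ n) < 1ℚ →
                       IsInteger (D * e) → IsInteger (D * e′) →
                       ⅔ ^ n < e - e′ + ⁵⁄₄ * ⅔ ^ n′ → ⅔ ^ n′ < e′ - e + ⁵⁄₄ * ⅔ ^ n → ⊥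
no-integer-in-window {D} {e} {e′} n n′ 0<D n<n′ small De∈ℤ De′∈ℤ lower upper =
  <-irrefl refl (<-≤-trans (<-trans (*-monoˡ-<′ 0<D u<) small) (isInteger-pos⇒1≤ Du∈ℤ (*-pos 0<D 0<u)))
  where
  open ≤-Reasoning
  0≤⅔ = toWitness {a? = 0ℚ ≤? ⅔} _
  u = e - e′
  Du∈ℤ : IsInteger (D * u)
  Du∈ℤ = subst IsInteger (solve 3 (λ D e e′ → D :* e :- D :* e′ := D :* (e :- e′)) refl D e e′)
                         (isInteger-- De∈ℤ De′∈ℤ)
  0<u : 0ℚ < u
  0<u = begin-strict
    0ℚ
      <⟨ *-pos (toWitness {a? = 0ℚ <? 1ℚ - ⁵⁄₄ * ⅔} _) (^-pos n (toWitness {a? = 0ℚ <? ⅔} _)) ⟩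
    (1ℚ - ⁵⁄₄ * ⅔) * ⅔ ^ n
      ≡⟨ solve 1 (λ t → (con 1ℚ :- con ⁵⁄₄ :* con ⅔) :* t := t :- con ⁵⁄₄ :* (con ⅔ :* t)) refl (⅔ ^ n) ⟩
    ⅔ ^ n - ⁵⁄₄ * (⅔ * ⅔ ^ n)
      ≤⟨ +-monoʳ-≤ (⅔ ^ n) (neg-antimono-≤ (*-monoˡ-≤′ (toWitness {a? = 0ℚ ≤? ⁵⁄₄} _)
                                             (^-antimono {m = suc n} {n′} 0≤⅔ (toWitness {a? = ⅔ ≤? 1ℚ} _) n<n′))) ⟩
    ⅔ ^ n - ⁵⁄₄ * ⅔ ^ n′
      <⟨ +-monoˡ-< (- (⁵⁄₄ * ⅔ ^ n′)) lower ⟩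
    u + ⁵⁄₄ * ⅔ ^ n′ - ⁵⁄₄ * ⅔ ^ n′
      ≡⟨ solve 2 (λ u x → u :+ x :- x := u) refl u (⁵⁄₄ * ⅔ ^ n′) ⟩
    u ∎
  u< : u < ⁵⁄₄ * ⅔ ^ n
  u< = begin-strict
    u
      ≡⟨ sym (+-identityˡ u) ⟩
    0ℚ + u
      ≤⟨ +-monoˡ-≤ u (^-nonNeg n′ 0≤⅔) ⟩
    ⅔ ^ n′ + u
      <⟨ +-monoˡ-< u upper ⟩
    e′ - e + ⁵⁄₄ * ⅔ ^ n + u
      ≡⟨ solve 3 (λ e e′ x → e′ :- e :+ x :+ (e :- e′) := x) refl e e′ (⁵⁄₄ * ⅔ ^ n) ⟩
    ⁵⁄₄ * ⅔ ^ n ∎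

module InfiniteDiscountTwo (B : NMDA 3) (ρ≡2 : ∀ p σ q → T (NMDA.δ B p σ q) → NMDA.ρ B p σ q ≡ ℕtoℚ 2) where
  open NMDA B
  open Automaton B
  open UniformDiscount B 2 ℕₚ.≤-refl ρ≡2

  scaledPrefix : ∀ n → IRun (word 𝐜 n) → ℚ
  scaledPrefix n R = L ^ n * partial R n

  scaledPrefix-lattice : ∀ n (R : IRun (word 𝐜 n)) → IsInteger (D * scaledPrefix n R)
  scaledPrefix-lattice n R = subst IsInteger
    (trans (*-assoc D (L ^ n) _) (cong (λ z → D * (L ^ n * z)) (sym (partial≡value R n))))
    (value-lattice (IRun.st-step R) n)

  module Exchange (n n′ : ℕ) (R : IRun (word 𝐜 n)) (R′ : IRun (word 𝐜 n′)) where
    β : ℚ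
    β = ½ ^ n * L ^ n′

    α : ℚ
    α = partial R n - β * partial R′ n′

    0<β : 0ℚ < β
    0<β = *-pos (^-pos n (toWitness {a? = 0ℚ <? ½} _)) (^-pos n′ (toWitness {a? = 0ℚ <? L} _))

    tail : ℕ → Fin m
    tail = shift n′ (IRun.st R′)

    partial-R′ : ∀ j → partial R′ (n′ ℕ.+ j) ≡ partial R′ n′ + ½ ^ n′ * value baω tail j
    partial-R′ j = trans (partial≡value R′ (n′ ℕ.+ j))
      (trans (value-splice n′ (IRun.st-step R′) (λ _ _ → refl)
                           (transition-shift {word 𝐜 n′} (IRun.st R′) n′ (splice-+ _ n′ baω)) j)
             (cong (_+ ½ ^ n′ * value baω tail j) (sym (partial≡value R′ n′))))

    rescaled : L ^ n * (α + β * (⁵⁄₄ * ⅓ ^ n′)) ≡ scaledPrefix n R - scaledPrefix n′ R′ + ⁵⁄₄ * ⅔ ^ n′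
    rescaled = begin
      L ^ n * (α + β * (⁵⁄₄ * ⅓ ^ n′))
        ≡⟨ solve 6 (λ Lⁿ P h Lⁿ′ P′ t → Lⁿ :* (P :- h :* Lⁿ′ :* P′ :+ h :* Lⁿ′ :* (con ⁵⁄₄ :* t))
                                        := Lⁿ :* P :- Lⁿ :* h :* (Lⁿ′ :* P′) :+ Lⁿ :* h :* (con ⁵⁄₄ :* (Lⁿ′ :* t)))
                   refl (L ^ n) (partial R n) (½ ^ n) (L ^ n′) (partial R′ n′) (⅓ ^ n′) ⟩
      L ^ n * partial R n - L ^ n * ½ ^ n * scaledPrefix n′ R′ + L ^ n * ½ ^ n * (⁵⁄₄ * (L ^ n′ * ⅓ ^ n′))
        ≡⟨ cong₂ (λ x y → L ^ n * partial R n - x * scaledPrefix n′ R′ + x * (⁵⁄₄ * y))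
                 (^-inverse n L*μ≡1) (sym (^-distrib-* L ⅓ n′)) ⟩
      scaledPrefix n R - 1ℚ * scaledPrefix n′ R′ + 1ℚ * (⁵⁄₄ * ⅔ ^ n′)
        ≡⟨ solve 3 (λ x y z → x :- con 1ℚ :* y :+ con 1ℚ :* z := x :- y :+ z)
                   refl (scaledPrefix n R) (scaledPrefix n′ R′) (⁵⁄₄ * ⅔ ^ n′) ⟩
      scaledPrefix n R - scaledPrefix n′ R′ + ⁵⁄₄ * ⅔ ^ n′ ∎
      where open ≡-Reasoning

    module _ (sₙ≡s′ₙ′ : IRun.st R n ≡ IRun.st R′ n′) where
      tail₀≡sₙ : tail 0 ≡ IRun.st R n
      tail₀≡sₙ = trans (cong (IRun.st R′) (ℕₚ.+-identityʳ n′)) (sym sₙ≡s′ₙ′)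

      exchanged : IRun (word 𝐜 n)
      exchanged = spliceRun n R tail (valid-shift {word 𝐜 n′} n′ (IRun.st-step R′) (splice-+ _ n′ baω)) tail₀≡sₙ
                            (λ _ _ → refl) (splice-+ _ n baω)

      exchanged-partial : ∀ j → partial exchanged (n ℕ.+ j) ≡ α + β * partial R′ (n′ ℕ.+ j)
      exchanged-partial j = begin
        partial exchanged (n ℕ.+ j)
          ≡⟨ trans (partial≡value exchanged (n ℕ.+ j))
                   (value-splice n (IRun.st-step R) (transition-splice-< n tail₀≡sₙ (λ _ _ → refl))
                                 (transition-splice-+ {word 𝐜 n} n (splice-+ _ n baω)) j) ⟩
        value (word 𝐜 n) (IRun.st R) n + ½ ^ n * V
          ≡⟨ cong (_+ ½ ^ n * V) (sym (partial≡value R n)) ⟩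
        partial R n + ½ ^ n * V
          ≡⟨ cong (λ z → partial R n + ½ ^ n * z) (sym (trans (cong (_* V) (^-inverse n′ L*μ≡1)) (*-identityˡ V))) ⟩
        partial R n + ½ ^ n * (L ^ n′ * ½ ^ n′ * V)
          ≡⟨ solve 6 (λ P h Lⁿ′ P′ hⁿ′ V → P :+ h :* (Lⁿ′ :* hⁿ′ :* V)
                                          := P :- h :* Lⁿ′ :* P′ :+ h :* Lⁿ′ :* (P′ :+ hⁿ′ :* V))
                   refl (partial R n) (½ ^ n) (L ^ n′) (partial R′ n′) (½ ^ n′) V ⟩
        α + β * (partial R′ n′ + ½ ^ n′ * V)
          ≡⟨ cong (λ z → α + β * z) (sym (partial-R′ j)) ⟩
        α + β * partial R′ (n′ ℕ.+ j) ∎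
        where
        open ≡-Reasoning
        V = value baω tail j

  module _ (equal : ∀ w → InfEq 𝒜 B w) where
    B-InfLess⇔ : ∀ n {q} → InfLess (word 𝐜 n) q ⇔ ⅓ ^ n < q
    B-InfLess⇔ n {q} = mk⇔ (Equivalence.to 𝒜⇔ ∘ proj₂ (equal (word 𝐜 n) q))
                           (proj₁ (equal (word 𝐜 n) q) ∘ Equivalence.from 𝒜⇔)
      where 𝒜⇔ = 𝒜-InfLess⇔ (suc n) (𝒜-partial-word 𝐜 n refl)

    exchange : ∀ n n′ (R : IRun (word 𝐜 n)) (R′ : IRun (word 𝐜 n′)) → IRun.st R n ≡ IRun.st R′ n′ →
               LimsupLess (partial R′) (⁵⁄₄ * ⅓ ^ n′) →
               ⅔ ^ n < scaledPrefix n R - scaledPrefix n′ R′ + ⁵⁄₄ * ⅔ ^ n′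
    exchange n n′ R R′ sₙ≡s′ₙ′ R′-below = begin-strict
      ⅔ ^ n                             ≡⟨ ^-distrib-* L ⅓ n ⟩
      L ^ n * ⅓ ^ n                     <⟨ *-monoˡ-<′ (^-pos n (toWitness {a? = 0ℚ <? L} _)) ⅓ⁿ<cut ⟩
      L ^ n * (α + β * (⁵⁄₄ * ⅓ ^ n′))  ≡⟨ rescaled ⟩
      scaledPrefix n R - scaledPrefix n′ R′ + ⁵⁄₄ * ⅔ ^ n′ ∎
      where
      open ≤-Reasoning
      open Exchange n n′ R R′
      X = exchanged sₙ≡s′ₙ′
      X-below : LimsupLess (partial X) (α + β * (⁵⁄₄ * ⅓ ^ n′))
      X-below = LimsupLess-transfer {partial R′} {partial X} {α = α} n n′ 0<β
                                    (≤-reflexive ∘ exchanged-partial sₙ≡s′ₙ′) R′-below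
      ⅓ⁿ<cut : ⅓ ^ n < α + β * (⁵⁄₄ * ⅓ ^ n′)
      ⅓ⁿ<cut = ≰⇒> (λ cut≤⅓ⁿ →
        <-irrefl refl (Equivalence.to (B-InfLess⇔ n) (X , LimsupLess-mono {partial X} cut≤⅓ⁿ X-below)))

    run : ∀ n → InfLess (word 𝐜 n) (⁵⁄₄ * ⅓ ^ n)
    run n = Equivalence.from (B-InfLess⇔ n)
      (subst (_< ⁵⁄₄ * ⅓ ^ n) (*-identityˡ (⅓ ^ n))
             (*-monoˡ-<-pos (⅓ ^ n) {{ℚ.positive (^-pos n (toWitness {a? = 0ℚ <? ⅓} _))}} (toWitness {a? = 1ℚ <? ⁵⁄₄} _)))

    module _ (N : ℕ) (small : ∀ n → N ℕ.≤ n → D * ⁵⁄₄ * ⅔ ^ n < 1ℚ) where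
      index : Fin (suc m) → ℕ
      index i = N ℕ.+ toℕ i

      R : ∀ i → IRun (word 𝐜 (index i))
      R i = proj₁ (run (index i))

      state : Fin (suc m) → Fin m
      state i = IRun.st (R i) (index i)

      meeting-runs-contradict : ∀ i j → toℕ i ℕ.< toℕ j → state i ≡ state j → ⊥
      meeting-runs-contradict i j i<j stateᵢ≡stateⱼ =
        no-integer-in-window {D} {scaledPrefix (index i) (R i)} {scaledPrefix (index j) (R j)} (index i) (index j) 0<D
          (ℕₚ.+-monoʳ-< N i<j)
          (subst (_< 1ℚ) (*-assoc D ⁵⁄₄ (⅔ ^ index i)) (small (index i) (ℕₚ.m≤m+n N (toℕ i))))
          (scaledPrefix-lattice (index i) (R i)) (scaledPrefix-lattice (index j) (R j))
          (exchange (index i) (index j) (R i) (R j) stateᵢ≡stateⱼ (proj₂ (run (index j))))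
          (exchange (index j) (index i) (R j) (R i) (sym stateᵢ≡stateⱼ) (proj₂ (run (index i))))

      two-runs-meet : ⊥
      two-runs-meet = let i , j , i<j , stateᵢ≡stateⱼ = pigeonhole (ℕₚ.n<1+n m) state in
                      meeting-runs-contradict i j i<j stateᵢ≡stateⱼ

  no-infinite-equivalence : ¬ (∀ w → InfEq 𝒜 B w)
  no-infinite-equivalence equal =
    two-runs-meet equal (proj₁ (⅔^n-eventually-small (D * ⁵⁄₄))) (proj₂ (⅔^n-eventually-small (D * ⁵⁄₄)))

no-finite-NDA : ∀ (B : NMDA 3) → IsIntegralNDA B → ¬ (∀ (σ : Fin 3) (ws : List (Fin 3)) → FinEq 𝒜 B (σ ∷ ws))
no-finite-NDA B (suc zero , s≤s () , _)
no-finite-NDA B (suc (suc zero) , _ , ρ≡2) = FiniteDiscountTwo.no-finite-equivalence B ρ≡2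
no-finite-NDA B (suc (suc (suc l)) , _ , ρ≡l) =
  FiniteLargeDiscount.no-finite-equivalence B (3 ℕ.+ l) (s≤s (s≤s (s≤s z≤n))) ρ≡l

no-infinite-NDA : ∀ (B : NMDA 3) → IsIntegralNDA B → ¬ (∀ (w : ℕ → Fin 3) → InfEq 𝒜 B w)
no-infinite-NDA B (suc zero , s≤s () , _)
no-infinite-NDA B (suc (suc zero) , _ , ρ≡2) = InfiniteDiscountTwo.no-infinite-equivalence B ρ≡2
no-infinite-NDA B (suc (suc (suc l)) , _ , ρ≡l) =
  InfiniteLargeDiscount.no-infinite-equivalence B (3 ℕ.+ l) (s≤s (s≤s (s≤s z≤n))) ρ≡l

theorem4p12 : ∃[ k ] (0 ℕ.< k × ∃[ A ] (IsLetterOriented {k} A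
                × (∀ (B : NMDA k) → IsIntegralNDA B → ¬ (∀ (σ : Fin k) (ws : List (Fin k)) → FinEq A B (σ ∷ ws)))
                × (∀ (B : NMDA k) → IsIntegralNDA B → ¬ (∀ (w : ℕ → Fin k) → InfEq A B w))))
theorem4p12 = 3 , s≤s z≤n , 𝒜 , 𝒜-letterOriented , no-finite-NDA , no-infinite-NDA
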